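{- Let $2\leq k\in\mathbb{N}$, let $\mathbf{X},\mathbf{A},\mathbf{B}$ be digraphs such that $\mathbf{A}\to\mathbf{B}$, and suppose that $\mathrm{BA}^k(\mathbf{X},\mathbf{A})=\textsc{Yes}$. Then $\mathrm{BA}^k(\mathbf{X},\mathbf{B})=\textsc{Yes}$.
   Context: Digraphs are finite; $\mathbf{A}\to\mathbf{B}$ means there is a map $f:V(\mathbf{A})\to V(\mathbf{B})$ with $(f(u),f(v))\in E(\mathbf{B})$ for all $(u,v)\in E(\mathbf{A})$. For a tuple $\mathbf{z}=(z_1,\dots,z_m)$ and $\mathbf{i}\in[m]^p$, $\mathbf{z}_{\mathbf{i}}=(z_{i_1},\dots,z_{i_p})$. For tuples of equal length, $\mathbf{s}\prec\mathbf{t}$ means $s_i=s_j\Rightarrow t_i=t_j$ for all $i,j$; $\not\prec$ is its negation. For digraphs $\mathbf{X},\mathbf{A}$ and $k\geq2$, take variables $\lambda_{\mathbf{x},\mathbf{a}}$ ($\mathbf{x}\in V(\mathbf{X})^k,\mathbf{a}\in V(\mathbf{A})^k$), $\mu_{\mathbf{y},\mathbf{b}}$ ($\mathbf{y}\in E(\mathbf{X}),\mathbf{b}\in E(\mathbf{A})$) and equations: (1) $\sum_{\mathbf{a}}\lambda_{\mathbf{x},\mathbf{a}}=1$; (2) $\sum_{\hat{\mathbf{a}}:\hat{\mathbf{a}}_{\mathbf{i}}=\mathbf{a}}\lambda_{\mathbf{x},\hat{\mathbf{a}}}=\lambda_{\mathbf{x}_{\mathbf{i}},\mathbf{a}}$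 for all $\mathbf{x},\mathbf{a}$, $\mathbf{i}\in[k]^k$; (3) $\sum_{\mathbf{b}\in E(\mathbf{A}):\mathbf{b}_{\mathbf{i}}=\mathbf{a}}\mu_{\mathbf{y},\mathbf{b}}=\lambda_{\mathbf{y}_{\mathbf{i}},\mathbf{a}}$ for all $\mathbf{y}\in E(\mathbf{X}),\mathbf{a}$, $\mathbf{i}\in[2]^k$; (4) $\lambda_{\mathbf{x},\mathbf{a}}=0$ if $\mathbf{x}\not\prec\mathbf{a}$; (5) $\mu_{\mathbf{y},\mathbf{b}}=0$ if $\mathbf{y}\not\prec\mathbf{b}$. $\mathrm{BA}^k(\mathbf{X},\mathbf{A})=\textsc{Yes}$ means the system has a nonnegative rational solution and an integer solution such that every variable equal to $0$ in the rational solution is $0$ in the integer solution. -}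

module Defs where

open import Data.Nat using (ℕ; zero; suc; _≤_)
open import Data.Fin using (Fin; zero; suc)
open import Data.Fin.Properties renaming (_≟_ to _≟F_)
open import Data.Bool using (Bool; true)
import Data.Bool.Properties as BoolP
open import Data.List using (List; []; _∷_; [_]; map; concatMap; allFin; filter; foldr)
open import Data.Vec using (Vec; []; _∷_; lookup) renaming (map to vmap)
open import Data.Vec.Properties using (≡-dec)
open import Data.Product using (Σ; ∃; _×_; _,_)
open import Relation.Nullary using (¬_; Dec)
open import Relation.Binary.PropositionalEquality using (_≡_)
open import Data.Rational as ℚ using (ℚ; 0ℚ; 1ℚ)
open import Data.Integer as ℤ using (ℤ)

record Digraph : Set where
  field
    size : ℕ
    adj  : Fin size → Fin size → Bool
open Digraph public

V : Digraph → Set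
V G = Fin (size G)

Tuple : Digraph → ℕ → Set
Tuple G p = Vec (V G) p

IsEdge : (G : Digraph) → Tuple G 2 → Set
IsEdge G (u ∷ v ∷ []) = adj G u v ≡ true

isEdge? : (G : Digraph) → (b : Tuple G 2) → Dec (IsEdge G b)
isEdge? G (u ∷ v ∷ []) = adj G u v BoolP.≟ true

_⟶_ : Digraph → Digraph → Set
A ⟶ B = Σ (V A → V B) λ f → ∀ u v → adj A u v ≡ true → adj B (f u) (f v) ≡ true

_at_ : ∀ {A : Set} {m p} → Vec A m → Vec (Fin m) p → Vec A p
z at i = vmap (lookup z) i

_≺_ : ∀ {A B : Set} {p} → Vec A p → Vec B p → Set
s ≺ t = ∀ i j → lookup s i ≡ lookup s j → lookup t i ≡ lookup t j

allTuples : (n p : ℕ) → List (Vec (Fin n) p)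
allTuples n zero = [ [] ]
allTuples n (suc p) = concatMap (λ a → map (a ∷_) (allTuples n p)) (allFin n)

edges : (G : Digraph) → List (Tuple G 2)
edges G = filter (isEdge? G) (allTuples (size G) 2)

sumL : ∀ {R C : Set} → R → (R → R → R) → List C → (C → R) → R
sumL 0r _+_ xs f = foldr (λ c acc → f c + acc) 0r xs

-- The system of equations (1)–(5) of BA^k(X, A) over a carrier R with 0, 1, +.
-- lam x a = λ_{x,a};  mu y b = μ_{y,b} (only its values at edges y ∈ E(X), b ∈ E(A) matter).
record IsSolution (k : ℕ) (X A : Digraph) {R : Set} (0r 1r : R) (_+_ : R → R → R)
                  (lam : Tuple X k → Tuple A k → R)
                  (mu  : Tuple X 2 → Tuple A 2 → R) : Set where
  field
    eq1 : ∀ (x : Tuple X k) → sumL 0r _+_ (allTuples (size A) k) (lam x) ≡ 1r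
    eq2 : ∀ (x : Tuple X k) (a : Tuple A k) (i : Vec (Fin k) k) →
          sumL 0r _+_ (filter (λ â → ≡-dec _≟F_ (â at i) a) (allTuples (size A) k)) (lam x)
            ≡ lam (x at i) a
    eq3 : ∀ (y : Tuple X 2) → IsEdge X y → ∀ (a : Tuple A k) (i : Vec (Fin 2) k) →
          sumL 0r _+_ (filter (λ b → ≡-dec _≟F_ (b at i) a) (edges A)) (mu y)
            ≡ lam (y at i) a
    eq4 : ∀ (x : Tuple X k) (a : Tuple A k) → ¬ (x ≺ a) → lam x a ≡ 0r
    eq5 : ∀ (y : Tuple X 2) → IsEdge X y → ∀ (b : Tuple A 2) → IsEdge A b →
          ¬ (y ≺ b) → mu y b ≡ 0r

BAYes : (k : ℕ) (X A : Digraph) → Set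
BAYes k X A =
  Σ (Tuple X k → Tuple A k → ℚ) λ lamQ →
  Σ (Tuple X 2 → Tuple A 2 → ℚ) λ muQ →
  Σ (Tuple X k → Tuple A k → ℤ) λ lamZ →
  Σ (Tuple X 2 → Tuple A 2 → ℤ) λ muZ →
    IsSolution k X A 0ℚ 1ℚ ℚ._+_ lamQ muQ
    × (∀ x a → 0ℚ ℚ.≤ lamQ x a)
    × (∀ y → IsEdge X y → ∀ b → IsEdge A b → 0ℚ ℚ.≤ muQ y b)
    × IsSolution k X A (ℤ.+ 0) (ℤ.+ 1) ℤ._+_ lamZ muZ
    × (∀ x a → lamQ x a ≡ 0ℚ → lamZ x a ≡ ℤ.+ 0)
    × (∀ y → IsEdge X y → ∀ b → IsEdge A b → muQ y b ≡ 0ℚ → muZ y b ≡ ℤ.+ 0)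

{-# OPTIONS --safe #-}
-- Push both solutions forward along the homomorphism f : A → B, setting
-- λ′(x, b) = Σ_{f a = b} λ(x, a) and μ′(y, b) = Σ_{e ∈ E(A), f e = b} μ(y, e).
-- Pushing forward along f commutes with taking the marginals a ↦ a_i, so each
-- equation for B is the sum of equations for A over a fibre of f; the edge
-- equations also use that f maps E(A) into E(B), and the support equations that
-- y ≺ e implies y ≺ f e. A sum of nonnegative rationals vanishes only if every
-- summand does, so the zero pattern of the rational solution is still inherited
-- by the integer one.
module Submission where

open import Defs
open import Algebra.Bundles using (CommutativeSemigroup)
open import Algebra.Structures using (IsCommutativeMonoid)
open import Data.Bool using (true; false; if_then_else_)
open import Data.Fin using (Fin; zero; suc)
open import Data.Fin.Properties using (_≟_)
import Data.Integer as ℤ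
import Data.Integer.Properties as ℤ
open import Data.List using (List; []; _∷_; _++_; map; concatMap; allFin; filter; tabulate)
open import Data.List.Membership.Propositional using (_∈_)
open import Data.List.Membership.Propositional.Properties using (∈-filter⁻)
open import Data.List.Properties using (filter-accept; filter-reject; filter-all; filter-≐; map-tabulate)
open import Data.List.Relation.Unary.All using (universal-U)
open import Data.List.Relation.Unary.Any using (here; there)
open import Data.Nat using (ℕ; _≤_)
open import Data.Product using (_×_; _,_; proj₁; proj₂)
open import Data.Rational using (ℚ; 0ℚ)
import Data.Rational as ℚ
import Data.Rational.Properties as ℚ
open import Data.Vec using (Vec; []; _∷_; lookup) renaming (map to vmap)
open import Data.Vec.Properties using (≡-dec; map-∘; map-cong; lookup-map)
open import Level using (0ℓ)
open import Function using (_∘_; id)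
open import Relation.Binary.PropositionalEquality
open import Relation.Nullary using (¬_; Dec; does; yes; no)
open import Relation.Nullary.Decidable using (_×-dec_)
open import Relation.Unary using (Decidable)
open import Relation.Unary.Properties using (U?)

map-at : ∀ {A B : Set} {m p} (f : A → B) (a : Vec A m) (i : Vec (Fin m) p) →
         vmap f (a at i) ≡ vmap f a at i
map-at f a i = trans (sym (map-∘ f (lookup a) i)) (map-cong (λ j → sym (lookup-map j f a)) i)

≺-map : ∀ {A B C : Set} {p} (f : B → C) {s : Vec A p} {t : Vec B p} → s ≺ t → s ≺ vmap f t
≺-map f {t = t} s≺t i j sᵢ≡sⱼ = trans (lookup-map i f t) (trans (cong f (s≺t i j sᵢ≡sⱼ)) (sym (lookup-map j f t)))

∈-edges⁻ : ∀ {G : Digraph} {e : Tuple G 2} → e ∈ edges G → IsEdge G e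
∈-edges⁻ {G} e∈E = proj₂ (∈-filter⁻ (isEdge? G) {xs = allTuples (size G) 2} e∈E)

hom-edge : ∀ {A B : Digraph} ((f , _) : A ⟶ B) (e : Tuple A 2) → IsEdge A e → IsEdge B (vmap f e)
hom-edge (_ , f-hom) (u ∷ v ∷ []) = f-hom u v

_≟ᵛ_ : ∀ {n p} → (s t : Vec (Fin n) p) → Dec (s ≡ t)
_≟ᵛ_ = ≡-dec _≟_

fibre : ∀ {C : Set} {n p} → (C → Vec (Fin n) p) → List C → Vec (Fin n) p → List C
fibre g L t = filter (λ c → g c ≟ᵛ t) L

∈-fibre⁻ : ∀ {C : Set} {n p} (g : C → Vec (Fin n) p) (L : List C) t {c} → c ∈ fibre g L t → c ∈ L × g c ≡ t
∈-fibre⁻ g L t = ∈-filter⁻ (λ c → g c ≟ᵛ t) {xs = L}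

module _ {A : Set} {P Q : A → Set} (P? : Decidable P) (Q? : Decidable Q) where

  filter-≐-∈ : ∀ xs → (∀ {x} → x ∈ xs → P x → Q x) → (∀ {x} → x ∈ xs → Q x → P x) →
               filter P? xs ≡ filter Q? xs
  filter-≐-∈ [] P⇒Q Q⇒P = refl
  filter-≐-∈ (x ∷ xs) P⇒Q Q⇒P with P? x | filter-≐-∈ xs (P⇒Q ∘ there) (Q⇒P ∘ there)
  ... | yes Px  | ih = trans (cong (x ∷_) ih) (sym (filter-accept Q? (P⇒Q (here refl) Px)))
  ... | no ¬Px | ih = trans ih (sym (filter-reject Q? (¬Px ∘ Q⇒P (here refl))))

  filter-filter : ∀ xs → filter P? (filter Q? xs) ≡ filter (λ x → Q? x ×-dec P? x) xs
  filter-filter [] = refl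
  filter-filter (x ∷ xs) with does (Q? x)
  ... | false = filter-filter xs
  ... | true with does (P? x)
  ...   | false = filter-filter xs
  ...   | true = cong (x ∷_) (filter-filter xs)

module Sums {R : Set} {0r : R} {_+_ : R → R → R} (isCM : IsCommutativeMonoid _≡_ _+_ 0r) where
  open IsCommutativeMonoid isCM using (assoc; identityˡ; identityʳ; isCommutativeSemigroup)

  +-commutativeSemigroup : CommutativeSemigroup 0ℓ 0ℓ
  +-commutativeSemigroup = record { isCommutativeSemigroup = isCommutativeSemigroup }

  open import Algebra.Properties.CommutativeSemigroup +-commutativeSemigroup using (interchange)
  open ≡-Reasoning

  ∑ : ∀ {C : Set} → List C → (C → R) → R
  ∑ = sumL 0r _+_

  iverson : ∀ {Q : Set} → Dec Q → R → R
  iverson d v = if does d then v else 0r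

  ∑-cong : ∀ {C : Set} (L : List C) {g h : C → R} → (∀ c → g c ≡ h c) → ∑ L g ≡ ∑ L h
  ∑-cong []      g≗h = refl
  ∑-cong (c ∷ L) g≗h = cong₂ _+_ (g≗h c) (∑-cong L g≗h)

  ∑-zero : ∀ {C : Set} (L : List C) {g : C → R} → (∀ {c} → c ∈ L → g c ≡ 0r) → ∑ L g ≡ 0r
  ∑-zero []      g≡0 = refl
  ∑-zero (c ∷ L) g≡0 = trans (cong₂ _+_ (g≡0 (here refl)) (∑-zero L (g≡0 ∘ there))) (identityˡ 0r)

  ∑-distrib : ∀ {C : Set} (L : List C) (g h : C → R) → ∑ L (λ c → g c + h c) ≡ ∑ L g + ∑ L h
  ∑-distrib []      g h = sym (identityˡ 0r)
  ∑-distrib (c ∷ L) g h =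
    trans (cong ((g c + h c) +_) (∑-distrib L g h)) (interchange (g c) (h c) (∑ L g) (∑ L h))

  ∑-comm : ∀ {C D : Set} (L : List C) (T : List D) (h : C → D → R) →
           ∑ L (λ c → ∑ T (h c)) ≡ ∑ T (λ d → ∑ L (λ c → h c d))
  ∑-comm []      T h = sym (∑-zero T (λ _ → refl))
  ∑-comm (c ∷ L) T h = trans (cong (∑ T (h c) +_) (∑-comm L T h)) (sym (∑-distrib T (h c) _))

  ∑-++ : ∀ {C : Set} (xs ys : List C) (f : C → R) → ∑ (xs ++ ys) f ≡ ∑ xs f + ∑ ys f
  ∑-++ []       ys f = sym (identityˡ _)
  ∑-++ (x ∷ xs) ys f = trans (cong (f x +_) (∑-++ xs ys f)) (sym (assoc _ _ _))

  ∑-map : ∀ {C D : Set} (g : C → D) (L : List C) (f : D → R) → ∑ (map g L) f ≡ ∑ L (f ∘ g)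
  ∑-map g []      f = refl
  ∑-map g (x ∷ L) f = cong (f (g x) +_) (∑-map g L f)

  ∑-concatMap : ∀ {C D : Set} (F : C → List D) (L : List C) (f : D → R) →
                ∑ (concatMap F L) f ≡ ∑ L (λ c → ∑ (F c) f)
  ∑-concatMap F []      f = refl
  ∑-concatMap F (c ∷ L) f = trans (∑-++ (F c) (concatMap F L) f) (cong (∑ (F c) f +_) (∑-concatMap F L f))

  ∑-filter : ∀ {C : Set} {P : C → Set} (P? : Decidable P) (L : List C) (f : C → R) →
             ∑ (filter P? L) f ≡ ∑ L (λ c → iverson (P? c) (f c))
  ∑-filter P? []      f = refl
  ∑-filter P? (x ∷ L) f with does (P? x)
  ... | true  = cong (f x +_) (∑-filter P? L f)
  ... | false = trans (∑-filter P? L f) (sym (identityˡ _))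

  iverson-zero : ∀ {Q : Set} (d : Dec Q) → iverson d 0r ≡ 0r
  iverson-zero d with does d
  ... | true  = refl
  ... | false = refl

  iverson-∑ : ∀ {Q C : Set} (d : Dec Q) (L : List C) (g : C → R) →
              iverson d (∑ L g) ≡ ∑ L (λ c → iverson d (g c))
  iverson-∑ d L g with does d
  ... | true  = refl
  ... | false = sym (∑-zero L (λ _ → refl))

  iverson-×-dec : ∀ {Q Q' : Set} (d : Dec Q) (d' : Dec Q') v → iverson (d ×-dec d') v ≡ iverson d (iverson d' v)
  iverson-×-dec d d' v with does d
  ... | true  = refl
  ... | false = refl

  iverson-transport : ∀ {D : Set} {P : D → Set} (P? : Decidable P) {x y : D} (x≟y : Dec (x ≡ y)) v →
                      iverson (P? y) (iverson x≟y v) ≡ iverson x≟y (iverson (P? x) v)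
  iverson-transport P? (yes refl) v = refl
  iverson-transport P? (no _)     v = iverson-zero (P? _)

  ∑-allFin-suc : ∀ n (h : Fin (ℕ.suc n) → R) → ∑ (allFin (ℕ.suc n)) h ≡ h zero + ∑ (allFin n) (h ∘ suc)
  ∑-allFin-suc n h = cong (h zero +_) (begin
    ∑ (tabulate suc) h            ≡⟨ cong (λ L → ∑ L h) (sym (map-tabulate id suc)) ⟩
    ∑ (map suc (allFin n)) h      ≡⟨ ∑-map suc (allFin n) h ⟩
    ∑ (allFin n) (h ∘ suc)        ∎)

  ∑-allFin-iverson : ∀ {n} (i : Fin n) (h : Fin n → R) → ∑ (allFin n) (λ a → iverson (i ≟ a) (h a)) ≡ h i
  ∑-allFin-iverson {ℕ.suc n} zero h = begin
    ∑ (allFin (ℕ.suc n)) (λ a → iverson (zero ≟ a) (h a)) ≡⟨ ∑-allFin-suc n _ ⟩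
    h zero + ∑ (allFin n) (λ _ → 0r)                       ≡⟨ cong (h zero +_) (∑-zero (allFin n) (λ _ → refl)) ⟩
    h zero + 0r                                            ≡⟨ identityʳ (h zero) ⟩
    h zero                                                 ∎
  ∑-allFin-iverson {ℕ.suc n} (suc i) h = begin
    ∑ (allFin (ℕ.suc n)) (λ a → iverson (suc i ≟ a) (h a)) ≡⟨ ∑-allFin-suc n _ ⟩
    0r + ∑ (allFin n) (λ a → iverson (i ≟ a) (h (suc a)))   ≡⟨ identityˡ _ ⟩
    ∑ (allFin n) (λ a → iverson (i ≟ a) (h (suc a)))        ≡⟨ ∑-allFin-iverson i (h ∘ suc) ⟩
    h (suc i)                                               ∎

  ∑-allTuples-suc : ∀ n p (h : Vec (Fin n) (ℕ.suc p) → R) →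
                    ∑ (allTuples n (ℕ.suc p)) h ≡ ∑ (allFin n) (λ a → ∑ (allTuples n p) (λ t → h (a ∷ t)))
  ∑-allTuples-suc n p h =
    trans (∑-concatMap _ (allFin n) h) (∑-cong (allFin n) (λ a → ∑-map (a ∷_) (allTuples n p) h))

  ∑-allTuples-iverson : ∀ {n p} (s : Vec (Fin n) p) (h : Vec (Fin n) p → R) →
                        ∑ (allTuples n p) (λ t → iverson (s ≟ᵛ t) (h t)) ≡ h s
  ∑-allTuples-iverson []       h = identityʳ (h [])
  ∑-allTuples-iverson {n} {ℕ.suc p} (i ∷ s) h = begin
    ∑ (allTuples n (ℕ.suc p)) (λ t → iverson ((i ∷ s) ≟ᵛ t) (h t))
      ≡⟨ ∑-allTuples-suc n p _ ⟩
    ∑ (allFin n) (λ a → ∑ (allTuples n p) (λ t → iverson ((i ≟ a) ×-dec (s ≟ᵛ t)) (h (a ∷ t))))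
      ≡⟨ ∑-cong (allFin n) (λ a → ∑-cong (allTuples n p) (λ t → iverson-×-dec (i ≟ a) (s ≟ᵛ t) _)) ⟩
    ∑ (allFin n) (λ a → ∑ (allTuples n p) (λ t → iverson (i ≟ a) (iverson (s ≟ᵛ t) (h (a ∷ t)))))
      ≡⟨ ∑-cong (allFin n) (λ a → sym (iverson-∑ (i ≟ a) (allTuples n p) _)) ⟩
    ∑ (allFin n) (λ a → iverson (i ≟ a) (∑ (allTuples n p) (λ t → iverson (s ≟ᵛ t) (h (a ∷ t)))))
      ≡⟨ ∑-cong (allFin n) (λ a → cong (iverson (i ≟ a)) (∑-allTuples-iverson s (h ∘ (a ∷_)))) ⟩
    ∑ (allFin n) (λ a → iverson (i ≟ a) (h (a ∷ s)))
      ≡⟨ ∑-allFin-iverson i (λ a → h (a ∷ s)) ⟩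
    h (i ∷ s) ∎

  push : ∀ {C : Set} {n p} → (C → Vec (Fin n) p) → List C → (C → R) → Vec (Fin n) p → R
  push g L w t = ∑ (fibre g L t) w

  ∑-filter-push : ∀ {C : Set} {n p} {Q : Vec (Fin n) p → Set} (Q? : Decidable Q)
                  (g : C → Vec (Fin n) p) (L : List C) (w : C → R) →
                  ∑ (filter Q? (allTuples n p)) (push g L w) ≡ ∑ (filter (Q? ∘ g) L) w
  ∑-filter-push {n = n} {p} Q? g L w = begin
    ∑ (filter Q? T) (push g L w)
      ≡⟨ ∑-filter Q? T _ ⟩
    ∑ T (λ t → iverson (Q? t) (∑ (filter (λ c → g c ≟ᵛ t) L) w))
      ≡⟨ ∑-cong T (λ t → cong (iverson (Q? t)) (∑-filter _ L w)) ⟩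
    ∑ T (λ t → iverson (Q? t) (∑ L (λ c → iverson (g c ≟ᵛ t) (w c))))
      ≡⟨ ∑-cong T (λ t → iverson-∑ (Q? t) L _) ⟩
    ∑ T (λ t → ∑ L (λ c → iverson (Q? t) (iverson (g c ≟ᵛ t) (w c))))
      ≡⟨ ∑-comm T L _ ⟩
    ∑ L (λ c → ∑ T (λ t → iverson (Q? t) (iverson (g c ≟ᵛ t) (w c))))
      ≡⟨ ∑-cong L (λ c → ∑-cong T (λ t → iverson-transport Q? (g c ≟ᵛ t) (w c))) ⟩
    ∑ L (λ c → ∑ T (λ t → iverson (g c ≟ᵛ t) (iverson (Q? (g c)) (w c))))
      ≡⟨ ∑-cong L (λ c → ∑-allTuples-iverson (g c) _) ⟩
    ∑ L (λ c → iverson (Q? (g c)) (w c))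
      ≡⟨ ∑-filter (Q? ∘ g) L w ⟨
    ∑ (filter (Q? ∘ g) L) w ∎
    where T = allTuples n p

  ∑-push : ∀ {C : Set} {n p} (g : C → Vec (Fin n) p) (L : List C) (w : C → R) →
           ∑ (allTuples n p) (push g L w) ≡ ∑ L w
  ∑-push {n = n} {p} g L w = begin
    ∑ (allTuples n p) (push g L w)
      ≡⟨ cong (λ T → ∑ T (push g L w)) (filter-all U? (universal-U (allTuples n p))) ⟨
    ∑ (filter U? (allTuples n p)) (push g L w)
      ≡⟨ ∑-filter-push U? g L w ⟩
    ∑ (filter (U? ∘ g) L) w
      ≡⟨ cong (λ L′ → ∑ L′ w) (filter-all (U? ∘ g) (universal-U L)) ⟩
    ∑ L w ∎

  module Pushforward {k : ℕ} {X A B : Digraph} (hom : A ⟶ B) where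
    f : V A → V B
    f = proj₁ hom

    pushλ : (Tuple X k → Tuple A k → R) → Tuple X k → Tuple B k → R
    pushλ lam x = push (vmap f) (allTuples (size A) k) (lam x)

    pushμ : (Tuple X 2 → Tuple A 2 → R) → Tuple X 2 → Tuple B 2 → R
    pushμ mu y = push (vmap f) (edges A) (mu y)

    isSolution-push : ∀ {1r lam mu} → IsSolution k X A 0r 1r _+_ lam mu →
                      IsSolution k X B 0r 1r _+_ (pushλ lam) (pushμ mu)
    isSolution-push {1r} {lam} {mu} sol = record
      { eq1 = normalised ; eq2 = consistent ; eq3 = edge-consistent ; eq4 = supported ; eq5 = edge-supported }
      where
      open IsSolution sol

      allA : List (Tuple A k)
      allA = allTuples (size A) k

      allB : List (Tuple B k)
      allB = allTuples (size B) k

      normalised : ∀ x → ∑ allB (pushλ lam x) ≡ 1r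
      normalised x = trans (∑-push (vmap f) allA (lam x)) (eq1 x)

      consistent : ∀ x (b : Tuple B k) (i : Vec (Fin k) k) →
                   push (_at i) allB (pushλ lam x) b ≡ pushλ lam (x at i) b
      consistent x b i = begin
        ∑ (filter (λ b̂ → (b̂ at i) ≟ᵛ b) allB) (pushλ lam x)
          ≡⟨ ∑-filter-push (λ b̂ → (b̂ at i) ≟ᵛ b) (vmap f) allA (lam x) ⟩
        ∑ (filter (λ a → (vmap f a at i) ≟ᵛ b) allA) (lam x)
          ≡⟨ cong (λ L → ∑ L (lam x))
               (filter-≐ _ _ ((λ {a} → trans (map-at f a i)) , (λ {a} → trans (sym (map-at f a i)))) allA) ⟩
        ∑ (filter (λ a → vmap f (a at i) ≟ᵛ b) allA) (lam x)
          ≡⟨ ∑-filter-push (λ a → vmap f a ≟ᵛ b) (_at i) allA (lam x) ⟨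
        ∑ (fibre (vmap f) allA b) (push (_at i) allA (lam x))
          ≡⟨ ∑-cong (fibre (vmap f) allA b) (λ a → eq2 x a i) ⟩
        pushλ lam (x at i) b ∎

      edge-consistent : ∀ y → IsEdge X y → ∀ (b : Tuple B k) (i : Vec (Fin 2) k) →
                        push (_at i) (edges B) (pushμ mu y) b ≡ pushλ lam (y at i) b
      edge-consistent y y∈E b i = begin
        ∑ (filter (λ e → (e at i) ≟ᵛ b) (edges B)) (pushμ mu y)
          ≡⟨ cong (λ L → ∑ L (pushμ mu y))
               (filter-filter (λ e → (e at i) ≟ᵛ b) (isEdge? B) (allTuples (size B) 2)) ⟩
        ∑ (filter (λ e → isEdge? B e ×-dec ((e at i) ≟ᵛ b)) (allTuples (size B) 2)) (pushμ mu y)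
          ≡⟨ ∑-filter-push (λ e → isEdge? B e ×-dec ((e at i) ≟ᵛ b)) (vmap f) (edges A) (mu y) ⟩
        ∑ (filter (λ e → isEdge? B (vmap f e) ×-dec ((vmap f e at i) ≟ᵛ b)) (edges A)) (mu y)
          ≡⟨ cong (λ L → ∑ L (mu y)) (filter-≐-∈ _ _ (edges A)
               (λ {e} _ → trans (map-at f e i) ∘ proj₂)
               (λ {e} e∈E eq → hom-edge hom e (∈-edges⁻ e∈E) , trans (sym (map-at f e i)) eq)) ⟩
        ∑ (filter (λ e → vmap f (e at i) ≟ᵛ b) (edges A)) (mu y)
          ≡⟨ ∑-filter-push (λ a → vmap f a ≟ᵛ b) (_at i) (edges A) (mu y) ⟨
        ∑ (fibre (vmap f) allA b) (push (_at i) (edges A) (mu y))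
          ≡⟨ ∑-cong (fibre (vmap f) allA b) (λ a → eq3 y y∈E a i) ⟩
        pushλ lam (y at i) b ∎

      supported : ∀ x (b : Tuple B k) → ¬ (x ≺ b) → pushλ lam x b ≡ 0r
      supported x b x⊀b = ∑-zero (fibre (vmap f) allA b) λ {a} a∈ →
        eq4 x a (λ x≺a → x⊀b (subst (x ≺_) (proj₂ (∈-fibre⁻ (vmap f) allA b a∈)) (≺-map f {x} {a} x≺a)))

      edge-supported : ∀ y → IsEdge X y → ∀ (b : Tuple B 2) → IsEdge B b → ¬ (y ≺ b) → pushμ mu y b ≡ 0r
      edge-supported y y∈E b _ y⊀b = ∑-zero (fibre (vmap f) (edges A) b) λ {e} e∈ →
        let (e∈E , fe≡b) = ∈-fibre⁻ (vmap f) (edges A) b e∈ in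
        eq5 y y∈E e (∈-edges⁻ e∈E) (λ y≺e → y⊀b (subst (y ≺_) fe≡b (≺-map f {y} {e} y≺e)))

module ℚΣ = Sums ℚ.+-0-isCommutativeMonoid
module ℤΣ = Sums ℤ.+-0-isCommutativeMonoid
open ℚΣ using (∑)

nonNeg+nonNeg≡0⇒≡0ˡ : ∀ {p q : ℚ} → 0ℚ ℚ.≤ p → 0ℚ ℚ.≤ q → p ℚ.+ q ≡ 0ℚ → p ≡ 0ℚ
nonNeg+nonNeg≡0⇒≡0ˡ {p} {q} 0≤p 0≤q p+q≡0 =
  ℚ.≤-antisym (subst₂ ℚ._≤_ (ℚ.+-identityʳ p) p+q≡0 (ℚ.+-monoʳ-≤ p 0≤q)) 0≤p

∑-nonNeg : ∀ {C : Set} (L : List C) {g : C → ℚ} → (∀ {c} → c ∈ L → 0ℚ ℚ.≤ g c) → 0ℚ ℚ.≤ ∑ L g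
∑-nonNeg []      g≥0 = ℚ.≤-refl
∑-nonNeg (c ∷ L) {g} g≥0 =
  subst (ℚ._≤ g c ℚ.+ ∑ L g) (ℚ.+-identityˡ 0ℚ) (ℚ.+-mono-≤ (g≥0 (here refl)) (∑-nonNeg L (g≥0 ∘ there)))

∑-nonNeg-≡0 : ∀ {C : Set} (L : List C) {g : C → ℚ} → (∀ {c} → c ∈ L → 0ℚ ℚ.≤ g c) →
              ∑ L g ≡ 0ℚ → ∀ {c} → c ∈ L → g c ≡ 0ℚ
∑-nonNeg-≡0 (c ∷ L) g≥0 ∑≡0 (here refl) =
  nonNeg+nonNeg≡0⇒≡0ˡ (g≥0 (here refl)) (∑-nonNeg L (g≥0 ∘ there)) ∑≡0
∑-nonNeg-≡0 (c ∷ L) {g} g≥0 ∑≡0 (there d∈L) =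
  ∑-nonNeg-≡0 L (g≥0 ∘ there) (nonNeg+nonNeg≡0⇒≡0ˡ (∑-nonNeg L (g≥0 ∘ there)) (g≥0 (here refl))
    (trans (ℚ.+-comm (∑ L g) (g c)) ∑≡0)) d∈L

∑≡0-transfer : ∀ {C : Set} (L : List C) {g : C → ℚ} {h : C → ℤ.ℤ} → (∀ {c} → c ∈ L → 0ℚ ℚ.≤ g c) →
            (∀ {c} → c ∈ L → g c ≡ 0ℚ → h c ≡ ℤ.+ 0) → ∑ L g ≡ 0ℚ → ℤΣ.∑ L h ≡ ℤ.+ 0
∑≡0-transfer L g≥0 supp ∑≡0 = ℤΣ.∑-zero L (λ c∈L → supp c∈L (∑-nonNeg-≡0 L g≥0 ∑≡0 c∈L))

proposition2p11 : (k : ℕ) → 2 ≤ k → (X A B : Digraph) → A ⟶ B → BAYes k X A → BAYes k X B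
proposition2p11 k _ X A B hom (lamQ , muQ , lamZ , muZ , solQ , lamQ≥0 , muQ≥0 , solZ , lamZ-supp , muZ-supp) =
  Q.pushλ lamQ , Q.pushμ muQ , Z.pushλ lamZ , Z.pushμ muZ ,
  Q.isSolution-push solQ ,
  (λ x b → ∑-nonNeg (fibre f allA b) (λ _ → lamQ≥0 x _)) ,
  (λ y y∈E b _ → ∑-nonNeg (fibre f (edges A) b) (λ e∈ → muQ≥0 y y∈E _ (edge e∈))) ,
  Z.isSolution-push solZ ,
  (λ x b → ∑≡0-transfer (fibre f allA b) (λ _ → lamQ≥0 x _) (λ _ → lamZ-supp x _)) ,
  (λ y y∈E b _ → ∑≡0-transfer (fibre f (edges A) b) (λ e∈ → muQ≥0 y y∈E _ (edge e∈))
                   (λ e∈ → muZ-supp y y∈E _ (edge e∈)))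
  where
  module Q = ℚΣ.Pushforward {k} {X} {A} {B} hom
  module Z = ℤΣ.Pushforward {k} {X} {A} {B} hom

  f : ∀ {p} → Tuple A p → Tuple B p
  f = vmap (proj₁ hom)

  allA : List (Tuple A k)
  allA = allTuples (size A) k

  edge : ∀ {b e} → e ∈ fibre f (edges A) b → IsEdge A e
  edge {b} = ∈-edges⁻ ∘ proj₁ ∘ ∈-fibre⁻ f (edges A) b
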